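{- Let $m<p$ be positive integers, $\Sigma_m=\{0,\dots,m\}$, $f:\Sigma_m\to\{0,\dots,p\}$ strictly increasing with $f(0)=0$, $f(m)=p$, and let $\{C_n\}$ be the associated Cantor-integers. Then for every $k\ge2$ and every digit string $\epsilon_k\cdots\epsilon_1$ with $\epsilon_k\in\{1,\dots,m\}$ and $\epsilon_{k-1},\dots,\epsilon_1\in\Sigma_m$, setting $n=[\epsilon_k\cdots\epsilon_1]_{m+1}$, \[\frac{C_n}{n}\ge\frac{f(m)+m+1}{2m+1}.\]
   Context: $[\epsilon_k\cdots\epsilon_1]_{m+1}=\sum_{j=1}^k\epsilon_j(m+1)^{j-1}$. Cantor-integers: for $n=\sum_{j=0}^k\epsilon_j(m+1)^j$ with $\epsilon_j\in\Sigma_m$, $C_n=\sum_{j=0}^k f(\epsilon_j)(p+1)^j$. -}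

module Defs where

open import Data.Nat using (ℕ; zero; suc; _+_; _*_; _<_; _≤_)
open import Data.Nat.DivMod using (_/_; _%_; m%n<n)
open import Data.Fin using (Fin; fromℕ<; toℕ)
open import Data.Vec using (Vec; []; _∷_)

-- Base-(m+1) value of a digit string given least-significant digit first:
-- value (ε₁ ∷ ε₂ ∷ … ∷ εₖ ∷ []) = Σ_j ε_j (m+1)^(j-1) = [εₖ⋯ε₁]_{m+1}.
value : {m k : ℕ} → Vec (Fin (suc m)) k → ℕ
value [] = 0
value {m} (e ∷ es) = toℕ e + suc m * value es

-- Cantor-integer C_n: expand n in base m+1 (digits ε_j ∈ Σ_m = Fin (suc m)),
-- replace each digit by f(ε_j) and read the result in base p+1.
-- Recursion with fuel; fuel n suffices since n / (m+1) < n for n > 0.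
cantorAux : (m p : ℕ) → (Fin (suc m) → ℕ) → ℕ → ℕ → ℕ
cantorAux m p f zero n = 0
cantorAux m p f (suc fuel) zero = 0
cantorAux m p f (suc fuel) (suc n) =
  f (fromℕ< (m%n<n (suc n) (suc m))) + suc p * cantorAux m p f fuel (suc n / suc m)

cantor : (m p : ℕ) → (Fin (suc m) → ℕ) → ℕ → ℕ
cantor m p f n = cantorAux m p f n n

-- Write n = ε₁ + (m+1) v, where v ≥ 1 is the number formed by the higher digits. Unfolding
-- the Cantor map once gives C_n = f(ε₁) + (p+1) C_v, and C_v ≥ v because f(i) ≥ i
-- (f is strictly increasing) and p ≥ m. So C_n ≥ ε₁ + (p+1) v, and
--   (ε₁ + (p+1) v)(2m+1) − (p+m+1)(ε₁ + (m+1) v) = (p−m)(m v − ε₁) ≥ 0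
-- since ε₁ ≤ m ≤ m v.
module Submission where

open import Defs
open import Data.Nat using (ℕ; zero; suc; _+_; _*_; _<_; _≤_; _≥_; z≤n; s≤s; s≤s⁻¹)
open import Data.Nat.Properties
open import Data.Nat.DivMod using (_/_; _%_; [m+kn]%n≡m%n; m<n⇒m%n≡m; +-distrib-/-∣ʳ; m<n⇒m/n≡0; m*n/n≡m)
open import Data.Nat.Divisibility using (divides-refl)
open import Data.Nat.Tactic.RingSolver using (solve-∀)
open import Data.Fin using (Fin; toℕ; fromℕ; fromℕ<)
open import Data.Fin.Properties using (toℕ-injective; toℕ-fromℕ<; fromℕ<-toℕ; toℕ<n; toℕ≤pred[n])
open import Data.Vec using (Vec; last; []; _∷_)
open import Data.Product using (_×_; _,_)
open import Relation.Binary.PropositionalEquality using (_≡_; refl; sym; trans; cong; cong₂; module ≡-Reasoning)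

module _ {m : ℕ} where

  digit-% : (d : Fin (suc m)) (v : ℕ) → (toℕ d + suc m * v) % suc m ≡ toℕ d
  digit-% d v = begin
    (toℕ d + suc m * v) % suc m  ≡⟨ cong (λ x → (toℕ d + x) % suc m) (*-comm (suc m) v) ⟩
    (toℕ d + v * suc m) % suc m  ≡⟨ [m+kn]%n≡m%n (toℕ d) v (suc m) ⟩
    toℕ d % suc m                ≡⟨ m<n⇒m%n≡m (toℕ<n d) ⟩
    toℕ d                        ∎
    where open ≡-Reasoning

  digit-/ : (d : Fin (suc m)) (v : ℕ) → (toℕ d + suc m * v) / suc m ≡ v
  digit-/ d v = begin
    (toℕ d + suc m * v) / suc m         ≡⟨ cong (λ x → (toℕ d + x) / suc m) (*-comm (suc m) v) ⟩
    (toℕ d + v * suc m) / suc m         ≡⟨ +-distrib-/-∣ʳ (toℕ d) (divides-refl v) ⟩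
    toℕ d / suc m + v * suc m / suc m   ≡⟨ cong₂ _+_ (m<n⇒m/n≡0 (toℕ<n d)) (m*n/n≡m v (suc m)) ⟩
    v                                   ∎
    where open ≡-Reasoning

  digit+v≡0 : (d : Fin (suc m)) (v : ℕ) → toℕ d + suc m * v ≡ 0 → d ≡ Fin.zero × v ≡ 0
  digit+v≡0 d v eq =
    toℕ-injective (m+n≡0⇒m≡0 (toℕ d) eq) , m*n≡0⇒m≡0 v (suc m) (trans (*-comm v (suc m)) (m+n≡0⇒n≡0 (toℕ d) eq))

  [1+m]*v≤1+n⇒v≤n : 1 ≤ m → (v n : ℕ) → suc m * v ≤ suc n → v ≤ n
  [1+m]*v≤1+n⇒v≤n _ zero n _ = z≤n
  [1+m]*v≤1+n⇒v≤n 1≤m (suc v) n le =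
    s≤s⁻¹ (≤-trans (m<m*n (suc v) (suc m) (s≤s 1≤m)) (≤-trans (≤-reflexive (*-comm (suc v) (suc m))) le))

  value≥last : {k : ℕ} (ds : Vec (Fin (suc m)) (suc k)) → toℕ (last ds) ≤ value ds
  value≥last (d ∷ []) = ≤-reflexive (sym (trans (cong (toℕ d +_) (*-zeroʳ (suc m))) (+-identityʳ (toℕ d))))
  value≥last (d ∷ ds@(_ ∷ _)) = ≤-trans (value≥last ds) (≤-trans (m≤n*m (value ds) (suc m)) (m≤n+m _ (toℕ d)))

  toℕ≤-of-strictlyIncreasing : (f : Fin (suc m) → ℕ) → (∀ (i j : Fin (suc m)) → toℕ i < toℕ j → f i < f j) →
                               (i : Fin (suc m)) → toℕ i ≤ f i
  toℕ≤-of-strictlyIncreasing f f-mono i =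
    ≤-trans (n≤f[n] (toℕ i) (toℕ<n i)) (≤-reflexive (cong f (fromℕ<-toℕ i (toℕ<n i))))
    where
      n≤f[n] : (n : ℕ) (n<1+m : n < suc m) → n ≤ f (fromℕ< n<1+m)
      n≤f[n] zero _ = z≤n
      n≤f[n] (suc n) 1+n<1+m = ≤-trans (s≤s (n≤f[n] n n<1+m))
        (f-mono _ _ (≤-reflexive (trans (cong suc (toℕ-fromℕ< n<1+m)) (sym (toℕ-fromℕ< 1+n<1+m)))))
        where
          n<1+m : n < suc m
          n<1+m = <-trans (n<1+n n) 1+n<1+m

module _ (m p : ℕ) (f : Fin (suc m) → ℕ) where

  cantorValue : {k : ℕ} → Vec (Fin (suc m)) k → ℕ
  cantorValue [] = 0
  cantorValue (d ∷ ds) = f d + suc p * cantorValue ds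

  cantorAux-zero : (fuel : ℕ) → cantorAux m p f fuel 0 ≡ 0
  cantorAux-zero zero = refl
  cantorAux-zero (suc fuel) = refl

  -- cantorAux stops at 0, so leading zero digits of a string must contribute f(0) = 0.
  module _ (f0≡0 : f Fin.zero ≡ 0) where

    cantorValue-zero : {k : ℕ} (ds : Vec (Fin (suc m)) k) → value ds ≡ 0 → cantorValue ds ≡ 0
    cantorValue-zero [] _ = refl
    cantorValue-zero (d ∷ ds) eq with digit+v≡0 d (value ds) eq
    ... | refl , v≡0 rewrite f0≡0 | cantorValue-zero ds v≡0 | *-zeroʳ p = refl

    cantorAux-digit : (fuel : ℕ) (d : Fin (suc m)) (v : ℕ) →
      cantorAux m p f (suc fuel) (toℕ d + suc m * v) ≡ f d + suc p * cantorAux m p f fuel v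
    cantorAux-digit fuel d v with toℕ d + suc m * v in eq
    ... | zero with digit+v≡0 d v eq
    ...   | refl , refl rewrite f0≡0 | cantorAux-zero fuel | *-zeroʳ p = refl
    cantorAux-digit fuel d v | suc n = cong₂ _+_
      (cong f (toℕ-injective (trans (toℕ-fromℕ< _) (trans (cong (_% suc m) (sym eq)) (digit-% d v)))))
      (cong (λ x → suc p * cantorAux m p f fuel x) (trans (cong (_/ suc m) (sym eq)) (digit-/ d v)))

    cantorAux-value : 1 ≤ m → (fuel : ℕ) {k : ℕ} (ds : Vec (Fin (suc m)) k) →
      value ds ≤ fuel → cantorAux m p f fuel (value ds) ≡ cantorValue ds
    cantorAux-value _ fuel [] _ = cantorAux-zero fuel
    cantorAux-value _ zero ds@(_ ∷ _) le = sym (cantorValue-zero ds (n≤0⇒n≡0 le))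
    cantorAux-value 1≤m (suc fuel) (d ∷ ds) le = trans (cantorAux-digit fuel d (value ds))
      (cong (λ c → f d + suc p * c)
        (cantorAux-value 1≤m fuel ds ([1+m]*v≤1+n⇒v≤n 1≤m (value ds) fuel (≤-trans (m≤n+m _ (toℕ d)) le))))

  value≤cantorValue : m ≤ p → (∀ i → toℕ i ≤ f i) → {k : ℕ} (ds : Vec (Fin (suc m)) k) →
                      value ds ≤ cantorValue ds
  value≤cantorValue m≤p toℕ≤f [] = z≤n
  value≤cantorValue m≤p toℕ≤f (d ∷ ds) =
    +-mono-≤ (toℕ≤f d) (*-mono-≤ (s≤s m≤p) (value≤cantorValue m≤p toℕ≤f ds))

digit-ratio-bound : {a m p v : ℕ} → a ≤ m → m ≤ p → 1 ≤ v →
  (p + m + 1) * (a + suc m * v) ≤ (a + suc p * v) * (2 * m + 1)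
digit-ratio-bound {a} a≤m m≤p 1≤v
  with m≤n⇒∃[o]m+o≡n a≤m | m≤n⇒∃[o]m+o≡n m≤p | m≤n⇒∃[o]m+o≡n 1≤v
... | u , refl | s , refl | w , refl = ≤-trans (m≤m+n _ _) (≤-reflexive (excess a u s w))
  where
    -- m = a + u, p = m + s, v = 1 + w; the excess (p − m)(m v − a) is s (u + m w).
    excess : ∀ a u s w →
      (a + u + s + (a + u) + 1) * (a + suc (a + u) * (1 + w)) + s * (u + (a + u) * w)
        ≡ (a + suc (a + u + s) * (1 + w)) * (2 * (a + u) + 1)
    excess = solve-∀

proposition2p1 : (m p : ℕ) → 1 ≤ m → m < p →
    (f : Fin (suc m) → ℕ) →
    (∀ (i j : Fin (suc m)) → toℕ i < toℕ j → f i < f j) →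
    f Fin.zero ≡ 0 → f (fromℕ m) ≡ p →
    (k : ℕ) → 2 ≤ suc k →
    (ε : Vec (Fin (suc m)) (suc k)) → 1 ≤ toℕ (last ε) →
    cantor m p f (value ε) * (2 * m + 1) ≥ (p + m + 1) * value ε
proposition2p1 _ _ _ _ _ _ _ _ zero (s≤s ()) _ _
proposition2p1 m p 1≤m m<p f f-mono f0≡0 _ (suc _) _ ε@(d ∷ ds) 1≤last = begin
  (p + m + 1) * value ε                              ≤⟨ digit-ratio-bound (toℕ≤pred[n] d) m≤p 1≤v ⟩
  (toℕ d + suc p * value ds) * (2 * m + 1)           ≤⟨ *-monoˡ-≤ (2 * m + 1) (+-mono-≤ (toℕ≤f d) (*-monoʳ-≤ (suc p) v≤C)) ⟩
  cantorValue m p f ε * (2 * m + 1)                  ≡⟨ cong (_* (2 * m + 1)) (sym (cantorAux-value m p f f0≡0 1≤m (value ε) ε ≤-refl)) ⟩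
  cantor m p f (value ε) * (2 * m + 1)               ∎
  where
    open ≤-Reasoning
    m≤p : m ≤ p
    m≤p = <⇒≤ m<p
    toℕ≤f : ∀ i → toℕ i ≤ f i
    toℕ≤f = toℕ≤-of-strictlyIncreasing f f-mono
    1≤v : 1 ≤ value ds
    1≤v = ≤-trans 1≤last (value≥last ds)
    v≤C : value ds ≤ cantorValue m p f ds
    v≤C = value≤cantorValue m p f m≤p toℕ≤f ds
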